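{- Let $\mathbb{F}$ be a field with $\operatorname{char}(\mathbb{F})\neq2$, $M\in\mathbb{F}^2$, $r\in\mathbb{F}^{*}$. Then $D^2(P,Q)\neq0$ for any two different points $P,Q\in C(M,r)_{\mathbb{F}}$.
   Context: $C(M,r)_{\mathbb{F}}=\{(x,y)\in\mathbb{F}^2:(x-m_1)^2+(y-m_2)^2=r^2\}$ for $M=(m_1,m_2)$, and $D^2((p_1,p_2),(q_1,q_2))=(p_1-q_1)^2+(p_2-q_2)^2$. -}

module Defs where

open import Level using (Level; suc; _⊔_)
open import Algebra.Bundles using (CommutativeRing)
open import Data.Product using (_×_; ∃)
open import Relation.Nullary using (¬_)

record Field (c ℓ : Level) : Set (suc (c ⊔ ℓ)) where
  field
    commutativeRing : CommutativeRing c ℓ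
  open CommutativeRing commutativeRing public
  field
    0≉1     : ¬ (0# ≈ 1#)
    inverse : ∀ x → ¬ (x ≈ 0#) → ∃ λ y → x * y ≈ 1#

module _ {c ℓ : Level} (F : Field c ℓ) where
  open Field F

  CharNot2 : Set ℓ
  CharNot2 = ¬ ((1# + 1#) ≈ 0#)

  Point : Set c
  Point = Carrier × Carrier

  _≈ₚ_ : Point → Point → Set ℓ
  (p₁ Data.Product., p₂) ≈ₚ (q₁ Data.Product., q₂) = (p₁ ≈ q₁) × (p₂ ≈ q₂)

  sq : Carrier → Carrier
  sq x = x * x

  D² : Point → Point → Carrier
  D² (p₁ Data.Product., p₂) (q₁ Data.Product., q₂) = sq (p₁ - q₁) + sq (p₂ - q₂)

  OnCircle : Point → Carrier → Point → Set ℓ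
  OnCircle (m₁ Data.Product., m₂) r (x Data.Product., y) =
    (sq (x - m₁) + sq (y - m₂)) ≈ sq r

-- Put a = P − M and e = P − Q. Both points lie on the circle, so the cosine law
-- |Q − M|² = |a|² − 2 a·e + |e|² gives 2 a·e = |e|² = D²(P,Q). If D²(P,Q) = 0 then,
-- as char F ≠ 2, e is an isotropic vector orthogonal to a, and |a|² = r² ≠ 0.
-- In the plane this forces e = 0, since |a|² e₁² = (a₁e₁ − a₂e₂)(a·e) + a₂²|e|²
-- and symmetrically for e₂; hence P = Q.
module Submission where

open import Defs
open import Level using (Level; 0ℓ)
open import Algebra.Bundles using (CommutativeRing; RawRing)
open import Algebra.Solver.Ring.AlmostCommutativeRing
  using (_-Raw-AlmostCommutative⟶_; fromCommutativeRing)
open import Data.Maybe using (Maybe; just; nothing)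
open import Data.Nat as ℕ using (ℕ; suc)
open import Data.Product using (_×_; _,_; proj₁; proj₂; swap)
open import Relation.Binary.PropositionalEquality as ≡ using (_≡_)
open import Relation.Nullary using (¬_; yes)

-- Integer coefficients for the ring solver: (a , b) stands for a − b, and
-- `normalise` cancels the common part, so equal integers have equal
-- representations and comparing them componentwise suffices.
module IntegerCoefficients {c ℓ} (R : CommutativeRing c ℓ) where
  open CommutativeRing R
  open import Algebra.Properties.Ring ring
    using (-‿+-comm; -‿distribˡ-*; -0#≈0#; [y-z]x≈yx-zx; x[y-z]≈xy-xz)
  open import Algebra.Properties.AbelianGroup +-abelianGroup using (⁻¹-anti-homo‿-)
  open import Algebra.Properties.CommutativeSemigroup +-commutativeSemigroup using (interchange)
  open import Algebra.Properties.Semiring.Mult semiring using (×-homo-+; ×1-homo-*)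
    renaming (_×_ to _×ᵣ_)
  open import Relation.Binary.Reasoning.Setoid setoid

  normalise : ℕ → ℕ → ℕ × ℕ
  normalise (suc a) (suc b) = normalise a b
  normalise a       b       = a , b

  ℤ-rawRing : RawRing 0ℓ 0ℓ
  ℤ-rawRing = record
    { Carrier = ℕ × ℕ
    ; _≈_     = _≡_
    ; _+_     = λ { (a , b) (c , d) → normalise (a ℕ.+ c) (b ℕ.+ d) }
    ; _*_     = λ { (a , b) (c , d) →
                  normalise (a ℕ.* c ℕ.+ b ℕ.* d) (a ℕ.* d ℕ.+ b ℕ.* c) }
    ; -_      = λ { (a , b) → b , a }
    ; 0#      = 0 , 0
    ; 1#      = 1 , 0
    }

  ⟦_⟧ℤ : ℕ × ℕ → Carrier
  ⟦ a , b ⟧ℤ = a ×ᵣ 1# - b ×ᵣ 1#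

  sub-+-interchange : ∀ x y z w → (x + z) - (y + w) ≈ (x - y) + (z - w)
  sub-+-interchange x y z w = begin
    (x + z) - (y + w)      ≈⟨ +-congˡ (-‿+-comm y w) ⟨
    (x + z) + (- y + - w)  ≈⟨ interchange x z (- y) (- w) ⟩
    (x - y) + (z - w)      ∎

  ⟦normalise⟧ : ∀ a b → ⟦ normalise a b ⟧ℤ ≈ a ×ᵣ 1# - b ×ᵣ 1#
  ⟦normalise⟧ 0       b       = refl
  ⟦normalise⟧ (suc a) 0       = refl
  ⟦normalise⟧ (suc a) (suc b) = begin
    ⟦ normalise a b ⟧ℤ                   ≈⟨ ⟦normalise⟧ a b ⟩
    a ×ᵣ 1# - b ×ᵣ 1#                    ≈⟨ +-identityˡ _ ⟨
    0# + (a ×ᵣ 1# - b ×ᵣ 1#)             ≈⟨ +-congʳ (-‿inverseʳ 1#) ⟨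
    (1# - 1#) + (a ×ᵣ 1# - b ×ᵣ 1#)      ≈⟨ sub-+-interchange 1# 1# (a ×ᵣ 1#) (b ×ᵣ 1#) ⟨
    (1# + a ×ᵣ 1#) - (1# + b ×ᵣ 1#)      ∎

  ⟦⟧-homo-+ : ∀ a b c d →
    ⟦ normalise (a ℕ.+ c) (b ℕ.+ d) ⟧ℤ ≈ ⟦ a , b ⟧ℤ + ⟦ c , d ⟧ℤ
  ⟦⟧-homo-+ a b c d = begin
    ⟦ normalise (a ℕ.+ c) (b ℕ.+ d) ⟧ℤ           ≈⟨ ⟦normalise⟧ (a ℕ.+ c) (b ℕ.+ d) ⟩
    (a ℕ.+ c) ×ᵣ 1# - (b ℕ.+ d) ×ᵣ 1#            ≈⟨ +-cong (×-homo-+ 1# a c) (-‿cong (×-homo-+ 1# b d)) ⟩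
    (a ×ᵣ 1# + c ×ᵣ 1#) - (b ×ᵣ 1# + d ×ᵣ 1#)    ≈⟨ sub-+-interchange _ _ _ _ ⟩
    ⟦ a , b ⟧ℤ + ⟦ c , d ⟧ℤ                      ∎

  difference-product : ∀ x y z w → (x * z + y * w) - (x * w + y * z) ≈ (x - y) * (z - w)
  difference-product x y z w = begin
    (x * z + y * w) - (x * w + y * z)            ≈⟨ +-congˡ (-‿cong (+-comm _ _)) ⟩
    (x * z + y * w) - (y * z + x * w)            ≈⟨ sub-+-interchange _ _ _ _ ⟩
    (x * z - y * z) + (y * w - x * w)            ≈⟨ +-cong ([y-z]x≈yx-zx z x y) ([y-z]x≈yx-zx w y x) ⟨
    (x - y) * z + (y - x) * w                    ≈⟨ +-congˡ (*-congʳ (⁻¹-anti-homo‿- x y)) ⟨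
    (x - y) * z + - (x - y) * w                  ≈⟨ +-congˡ (-‿distribˡ-* (x - y) w) ⟨
    (x - y) * z - (x - y) * w                    ≈⟨ x[y-z]≈xy-xz (x - y) z w ⟨
    (x - y) * (z - w)                            ∎

  ⟦⟧-homo-* : ∀ a b c d →
    ⟦ normalise (a ℕ.* c ℕ.+ b ℕ.* d) (a ℕ.* d ℕ.+ b ℕ.* c) ⟧ℤ ≈ ⟦ a , b ⟧ℤ * ⟦ c , d ⟧ℤ
  ⟦⟧-homo-* a b c d = begin
    ⟦ normalise (a ℕ.* c ℕ.+ b ℕ.* d) (a ℕ.* d ℕ.+ b ℕ.* c) ⟧ℤ
      ≈⟨ ⟦normalise⟧ (a ℕ.* c ℕ.+ b ℕ.* d) (a ℕ.* d ℕ.+ b ℕ.* c) ⟩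
    (a ℕ.* c ℕ.+ b ℕ.* d) ×ᵣ 1# - (a ℕ.* d ℕ.+ b ℕ.* c) ×ᵣ 1#
      ≈⟨ +-cong (sum-of-products a c b d) (-‿cong (sum-of-products a d b c)) ⟩
    (A * C + B * D) - (A * D + B * C)
      ≈⟨ difference-product A B C D ⟩
    ⟦ a , b ⟧ℤ * ⟦ c , d ⟧ℤ ∎
    where
    A B C D : Carrier
    A = a ×ᵣ 1#; B = b ×ᵣ 1#; C = c ×ᵣ 1#; D = d ×ᵣ 1#
    sum-of-products : ∀ m n p q → (m ℕ.* n ℕ.+ p ℕ.* q) ×ᵣ 1# ≈ (m ×ᵣ 1#) * (n ×ᵣ 1#) + (p ×ᵣ 1#) * (q ×ᵣ 1#)
    sum-of-products m n p q = trans (×-homo-+ 1# (m ℕ.* n) (p ℕ.* q)) (+-cong (×1-homo-* m n) (×1-homo-* p q))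

  ⟦⟧-homo-‿ : ∀ a b → b ×ᵣ 1# - a ×ᵣ 1# ≈ - (a ×ᵣ 1# - b ×ᵣ 1#)
  ⟦⟧-homo-‿ a b = sym (⁻¹-anti-homo‿- (a ×ᵣ 1#) (b ×ᵣ 1#))

  homomorphism : ℤ-rawRing -Raw-AlmostCommutative⟶ fromCommutativeRing R
  homomorphism = record
    { ⟦_⟧    = ⟦_⟧ℤ
    ; +-homo = λ { (a , b) (c , d) → ⟦⟧-homo-+ a b c d }
    ; *-homo = λ { (a , b) (c , d) → ⟦⟧-homo-* a b c d }
    ; -‿homo = λ { (a , b) → ⟦⟧-homo-‿ a b }
    ; 0-homo = trans (+-identityˡ _) -0#≈0#
    ; 1-homo = trans (+-cong (+-identityʳ 1#) -0#≈0#) (+-identityʳ 1#)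
    }

  _≟ℤ_ : ∀ x y → Maybe (⟦ x ⟧ℤ ≈ ⟦ y ⟧ℤ)
  (a , b) ≟ℤ (c , d) with a ℕ.≟ c | b ℕ.≟ d
  ... | yes ≡.refl | yes ≡.refl = just refl
  ... | _          | _          = nothing

  open import Algebra.Solver.Ring ℤ-rawRing (fromCommutativeRing R) homomorphism _≟ℤ_ public
    using (solve; _:=_; _:+_; _:*_; _:-_)

module FieldProperties {c ℓ} (F : Field c ℓ) where
  open Field F
  open import Algebra.Properties.Group +-group using (x∙y⁻¹≈ε⇒x≈y)
  open import Relation.Binary.Reasoning.Setoid setoid

  x≉0⇒x*y≈0⇒y≈0 : ∀ {x y} → ¬ x ≈ 0# → x * y ≈ 0# → y ≈ 0#
  x≉0⇒x*y≈0⇒y≈0 {x} {y} x≉0 xy≈0 with inverse x x≉0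
  ... | z , xz≈1 = begin
    y              ≈⟨ *-identityˡ y ⟨
    1# * y         ≈⟨ *-congʳ xz≈1 ⟨
    (x * z) * y    ≈⟨ *-congʳ (*-comm x z) ⟩
    (z * x) * y    ≈⟨ *-assoc z x y ⟩
    z * (x * y)    ≈⟨ *-congˡ xy≈0 ⟩
    z * 0#         ≈⟨ zeroʳ z ⟩
    0#             ∎

  -- Only ¬¬: inverses exist just for elements ≉ 0, and _≈_ need not be decidable.
  x*x≈0⇒¬¬x≈0 : ∀ {x} → x * x ≈ 0# → ¬ ¬ x ≈ 0#
  x*x≈0⇒¬¬x≈0 xx≈0 x≉0 = x≉0 (x≉0⇒x*y≈0⇒y≈0 x≉0 xx≈0)

  x≉0⇒x*x≉0 : ∀ {x} → ¬ x ≈ 0# → ¬ x * x ≈ 0#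
  x≉0⇒x*x≉0 x≉0 xx≈0 = x*x≈0⇒¬¬x≈0 xx≈0 x≉0

  x+x≈0⇒x≈0 : CharNot2 F → ∀ {x} → x + x ≈ 0# → x ≈ 0#
  x+x≈0⇒x≈0 char≢2 {x} x+x≈0 = x≉0⇒x*y≈0⇒y≈0 char≢2 (begin
    (1# + 1#) * x     ≈⟨ distribʳ x 1# 1# ⟩
    1# * x + 1# * x   ≈⟨ +-cong (*-identityˡ x) (*-identityˡ x) ⟩
    x + x             ≈⟨ x+x≈0 ⟩
    0#                ∎)

  x-y≈0⇒x≈y : ∀ {x y} → x - y ≈ 0# → x ≈ y
  x-y≈0⇒x≈y = x∙y⁻¹≈ε⇒x≈y _ _

module PlaneGeometry {c ℓ} (F : Field c ℓ) where
  open Field F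
  open FieldProperties F
  open IntegerCoefficients commutativeRing
  open import Relation.Binary.Reasoning.Setoid setoid

  infixl 6 _⊖_
  infix  7 _·_

  _⊖_ : Point F → Point F → Point F
  (p₁ , p₂) ⊖ (q₁ , q₂) = p₁ - q₁ , p₂ - q₂

  _·_ : Point F → Point F → Carrier
  (a₁ , a₂) · (b₁ , b₂) = a₁ * b₁ + a₂ * b₂

  0ₚ : Point F
  0ₚ = 0# , 0#

  ·-swap : ∀ a b → swap a · swap b ≈ a · b
  ·-swap _ _ = +-comm _ _

  ⊖≈ₚ0ₚ⇒≈ₚ : ∀ {P Q} → _≈ₚ_ F (P ⊖ Q) 0ₚ → _≈ₚ_ F P Q
  ⊖≈ₚ0ₚ⇒≈ₚ (e₁≈0 , e₂≈0) = x-y≈0⇒x≈y e₁≈0 , x-y≈0⇒x≈y e₂≈0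

  cosine-law : ∀ P Q M →
    (P ⊖ M) · (P ⊖ Q) + (P ⊖ M) · (P ⊖ Q) ≈ (D² F P M + D² F P Q) - D² F Q M
  cosine-law (p₁ , p₂) (q₁ , q₂) (m₁ , m₂) = solve 6 (λ p₁ p₂ q₁ q₂ m₁ m₂ →
    ((p₁ :- m₁) :* (p₁ :- q₁) :+ (p₂ :- m₂) :* (p₂ :- q₂))
      :+ ((p₁ :- m₁) :* (p₁ :- q₁) :+ (p₂ :- m₂) :* (p₂ :- q₂))
    := (((p₁ :- m₁) :* (p₁ :- m₁) :+ (p₂ :- m₂) :* (p₂ :- m₂))
         :+ ((p₁ :- q₁) :* (p₁ :- q₁) :+ (p₂ :- q₂) :* (p₂ :- q₂)))
       :- ((q₁ :- m₁) :* (q₁ :- m₁) :+ (q₂ :- m₂) :* (q₂ :- m₂)))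
    refl p₁ p₂ q₁ q₂ m₁ m₂

  concyclic⇒2·≈D² : ∀ {M r P Q} → OnCircle F M r P → OnCircle F M r Q →
    (P ⊖ M) · (P ⊖ Q) + (P ⊖ M) · (P ⊖ Q) ≈ D² F P Q
  concyclic⇒2·≈D² {M} {r} {P} {Q} P∈C Q∈C = begin
    (P ⊖ M) · (P ⊖ Q) + (P ⊖ M) · (P ⊖ Q)  ≈⟨ cosine-law P Q M ⟩
    (D² F P M + D² F P Q) - D² F Q M        ≈⟨ +-cong (+-congʳ P∈C) (-‿cong Q∈C) ⟩
    (sq F r + D² F P Q) - sq F r            ≈⟨ solve 2 (λ x y → (x :+ y) :- x := y) refl (sq F r) (D² F P Q) ⟩
    D² F P Q                                ∎

  a·a*e₁²-expansion : ∀ a e →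
    (a · a) * (proj₁ e * proj₁ e)
      ≈ (proj₁ a * proj₁ e - proj₂ a * proj₂ e) * (a · e) + (proj₂ a * proj₂ a) * (e · e)
  a·a*e₁²-expansion (a₁ , a₂) (e₁ , e₂) = solve 4 (λ a₁ a₂ e₁ e₂ →
    (a₁ :* a₁ :+ a₂ :* a₂) :* (e₁ :* e₁)
    := (a₁ :* e₁ :- a₂ :* e₂) :* (a₁ :* e₁ :+ a₂ :* e₂) :+ (a₂ :* a₂) :* (e₁ :* e₁ :+ e₂ :* e₂))
    refl a₁ a₂ e₁ e₂

  anisotropic⊥isotropic⇒proj₁²≈0 : ∀ {a e} → ¬ a · a ≈ 0# → a · e ≈ 0# → e · e ≈ 0# →
    proj₁ e * proj₁ e ≈ 0#
  anisotropic⊥isotropic⇒proj₁²≈0 {a} {e} a·a≉0 a·e≈0 e·e≈0 =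
    x≉0⇒x*y≈0⇒y≈0 a·a≉0 (begin
      (a · a) * (proj₁ e * proj₁ e)  ≈⟨ a·a*e₁²-expansion a e ⟩
      u * (a · e) + v * (e · e)      ≈⟨ +-cong (*-congˡ a·e≈0) (*-congˡ e·e≈0) ⟩
      u * 0# + v * 0#                ≈⟨ +-cong (zeroʳ u) (zeroʳ v) ⟩
      0# + 0#                        ≈⟨ +-identityʳ 0# ⟩
      0#                             ∎)
    where
    u v : Carrier
    u = proj₁ a * proj₁ e - proj₂ a * proj₂ e
    v = proj₂ a * proj₂ a

  anisotropic⊥isotropic⇒¬¬≈ₚ0ₚ : ∀ {a e} → ¬ a · a ≈ 0# → a · e ≈ 0# → e · e ≈ 0# →
    ¬ ¬ _≈ₚ_ F e 0ₚ
  anisotropic⊥isotropic⇒¬¬≈ₚ0ₚ {a} {e} a·a≉0 a·e≈0 e·e≈0 e≉0 =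
    x*x≈0⇒¬¬x≈0 e₁²≈0 λ e₁≈0 → x*x≈0⇒¬¬x≈0 e₂²≈0 λ e₂≈0 → e≉0 (e₁≈0 , e₂≈0)
    where
    e₁²≈0 : proj₁ e * proj₁ e ≈ 0#
    e₁²≈0 = anisotropic⊥isotropic⇒proj₁²≈0 a·a≉0 a·e≈0 e·e≈0
    e₂²≈0 : proj₂ e * proj₂ e ≈ 0#
    e₂²≈0 = anisotropic⊥isotropic⇒proj₁²≈0 {swap a} {swap e}
      (λ h → a·a≉0 (trans (sym (·-swap a a)) h))
      (trans (·-swap a e) a·e≈0)
      (trans (·-swap e e) e·e≈0)

mainTheorem16 : ∀ {c ℓ : Level} (F : Field c ℓ) → CharNot2 F →
    (M : Point F) (r : Field.Carrier F) → ¬ (Field._≈_ F r (Field.0# F)) →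
    (P Q : Point F) → OnCircle F M r P → OnCircle F M r Q →
    ¬ (_≈ₚ_ F P Q) → ¬ (Field._≈_ F (D² F P Q) (Field.0# F))
mainTheorem16 F char≢2 M r r≉0 P Q P∈C Q∈C P≉Q D²≈0 =
  anisotropic⊥isotropic⇒¬¬≈ₚ0ₚ a·a≉0 a·e≈0 D²≈0 (λ e≈0 → P≉Q (⊖≈ₚ0ₚ⇒≈ₚ e≈0))
  where
  open Field F using (_≈_; 0#; sym; trans)
  open FieldProperties F using (x≉0⇒x*x≉0; x+x≈0⇒x≈0)
  open PlaneGeometry F

  a·a≉0 : ¬ (P ⊖ M) · (P ⊖ M) ≈ 0#
  a·a≉0 a·a≈0 = x≉0⇒x*x≉0 r≉0 (trans (sym P∈C) a·a≈0)

  a·e≈0 : (P ⊖ M) · (P ⊖ Q) ≈ 0#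
  a·e≈0 = x+x≈0⇒x≈0 char≢2 (trans (concyclic⇒2·≈D² P∈C Q∈C) D²≈0)
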